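{- Let $n\ge 2$ and let $\tau_1,\dots,\tau_n$ be sporadic tasks, $\tau_i=(c_i,d_i,p_i,J_i)$ with nonnegative integers satisfying $c_i\ge 1$, $p_i\ge 1$, $c_i\le d_i\le p_i$ and $0\le J_i\le p_i$, and assume $\sum_{i<n}c_i/p_i<1$. Let \[ r_n=\min\Big\{t\in\mathbb{Z}_{\ge 0} : t\ge c_n+\sum_{i<n}c_i\Big\lceil\frac{t+J_i}{p_i}\Big\rceil\Big\}. \] Define \[ \ell=\frac{c_n+\sum_{i<n}\frac{J_i}{p_i}c_i}{1-\sum_{i<n}\frac{c_i}{p_i}},\quad u_1=\ell+\frac{\sum_{i<n}c_i}{1-\sum_{i<n}\frac{c_i}{p_i}},\quad u_2=\Big\lceil\frac{\sum_{i\le n}c_i}{(1-\sum_{i<n}\frac{c_i}{p_i})\,\mathrm{lcm}_{i<n}p_i}\Big\rceil\,\mathrm{lcm}_{i<n}p_i. \] Then $\ell\le r_n\le u:=\min\{u_1,u_2\}$.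
   Context: $r_n$ is the worst-case response time of task $\tau_n$ under fixed-priority scheduling with release jitter ($\tau_i$ has higher priority than $\tau_j$ iff $i<j$). $\mathrm{lcm}_{i<n}p_i$ is the least common multiple of $p_1,\dots,p_{n-1}$. -}

module Defs where

open import Data.Nat as ℕ using (ℕ; zero; suc; _+_; _∸_)
open import Data.Nat.DivMod using (_/_)
open import Data.Nat.LCM using (lcm)
open import Data.Fin using (Fin; zero; suc)
open import Data.Integer as ℤ using (ℤ; +_)
open import Data.Rational as ℚ using (ℚ; 0ℚ; 1ℚ; _÷_; ceiling; NonZero)
open import Relation.Nullary using (yes; no)
open import Data.Product using (_×_)

-- A sporadic task τ = (c, d, p, J): WCET, relative deadline, period, release jitter.
record Task : Set where
  constructor task
  field
    c d p J : ℕ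
open Task public

WellFormed : Task → Set
WellFormed τ = (1 ℕ.≤ c τ) × (1 ℕ.≤ p τ) × (c τ ℕ.≤ d τ) × (d τ ℕ.≤ p τ) × (J τ ℕ.≤ p τ)

-- ⌈ a / b ⌉ on naturals (convention: 0 when b = 0; never used since p ≥ 1).
ceilDiv : ℕ → ℕ → ℕ
ceilDiv a zero = 0
ceilDiv a (suc k) = (a + k) / suc k

-- a / b as a rational (convention: 0 when b = 0; never used since p ≥ 1).
fracℚ : ℕ → ℕ → ℚ
fracℚ a zero = 0ℚ
fracℚ a (suc k) = (+ a) ℚ./ suc k

-- x / y in ℚ (convention: 0 when y = 0; never used since 1 - U > 0).
divℚ : ℚ → ℚ → ℚ
divℚ x y with y ℚ.≟ 0ℚ
... | yes _ = 0ℚ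
... | no y≢0 = _÷_ x y {{ℚ.≢-nonZero y≢0}}

sumℕ : ∀ {m} → (Fin m → ℕ) → ℕ
sumℕ {zero} f = 0
sumℕ {suc m} f = f zero + sumℕ (λ i → f (suc i))

sumℚ : ∀ {m} → (Fin m → ℚ) → ℚ
sumℚ {zero} f = 0ℚ
sumℚ {suc m} f = f zero ℚ.+ sumℚ (λ i → f (suc i))

lcmFin : ∀ {m} → (Fin m → ℕ) → ℕ
lcmFin {zero} f = 1
lcmFin {suc m} f = lcm (f zero) (lcmFin (λ i → f (suc i)))

ℕ→ℚ : ℕ → ℚ
ℕ→ℚ k = (+ k) ℚ./ 1

-- Below, hp : Fin m → Task are the higher-priority tasks τ₁..τ_{n-1} (n = m + 1)
-- and τn is the task under analysis.

Util : ∀ {m} → (Fin m → Task) → ℚ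
Util hp = sumℚ (λ i → fracℚ (c (hp i)) (p (hp i)))

Feasible : ∀ {m} → (Fin m → Task) → Task → ℕ → Set
Feasible hp τn t = c τn + sumℕ (λ i → c (hp i) ℕ.* ceilDiv (t + J (hp i)) (p (hp i))) ℕ.≤ t

IsResponseTime : ∀ {m} → (Fin m → Task) → Task → ℕ → Set
IsResponseTime hp τn r = Feasible hp τn r × (∀ t → Feasible hp τn t → r ℕ.≤ t)

ell : ∀ {m} → (Fin m → Task) → Task → ℚ
ell hp τn = divℚ (ℕ→ℚ (c τn) ℚ.+ sumℚ (λ i → fracℚ (J (hp i)) (p (hp i)) ℚ.* ℕ→ℚ (c (hp i))))
                 (1ℚ ℚ.- Util hp)

u₁ : ∀ {m} → (Fin m → Task) → Task → ℚ
u₁ hp τn = ell hp τn ℚ.+ divℚ (ℕ→ℚ (sumℕ (λ i → c (hp i)))) (1ℚ ℚ.- Util hp)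

u₂ : ∀ {m} → (Fin m → Task) → Task → ℚ
u₂ hp τn = (ceiling (divℚ (ℕ→ℚ (sumℕ (λ i → c (hp i)) + c τn))
                   ((1ℚ ℚ.- Util hp) ℚ.* ℕ→ℚ L)) ℚ./ 1) ℚ.* ℕ→ℚ L
  where L = lcmFin (λ i → p (hp i))

module Submission where

-- Write U = Σ_{i<n} c_i/p_i and W(t) = c_n + Σ_{i<n} c_i ⌈(t + J_i)/p_i⌉, so that the
-- feasible t are those with W(t) ≤ t.  Since x ≤ ⌈x⌉ ≤ x + 1, W is sandwiched between
-- affine functions of slope U:  A + U t ≤ W(t) ≤ A + C + U t,  where A = c_n + Σ (J_i/p_i) c_i
-- and C = Σ_{i<n} c_i; and when every p_i divides t, J_i ≤ p_i gives ⌈(t + J_i)/p_i⌉ ≤ t/p_i + 1,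
-- whence W(t) ≤ C + c_n + U t.  As U < 1, the lower bound at the feasible r gives ℓ ≤ r.  W is
-- monotone, so W(r) is feasible too and minimality gives r ≤ W(r), whence r ≤ u₁ by the upper
-- bound.  Finally u₂ is a multiple of lcm_{i<n} p_i chosen so that the aligned bound makes it
-- feasible, so r ≤ u₂.

open import Defs
open import Data.Fin using (Fin; zero; suc)
open import Data.Product using (Σ; _×_; _,_; proj₁; proj₂)
open import Data.Nat using (ℕ; zero; suc)
import Data.Nat as ℕ
import Data.Nat.Properties as ℕP
import Data.Nat.Solver as ℕSolver
open import Data.Nat.DivMod using (_%_; m≡m%n+[m/n]*n; m%n<n; m/n*n≤m; /-monoˡ-≤; m<n*o⇒m/o<n)
open import Data.Nat.Divisibility using (_∣_; divides; ∣-trans; n∣m*n)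
open import Data.Nat.LCM using (lcm; m∣lcm[m,n]; n∣lcm[m,n]; gcd*lcm)
open import Data.Nat.GCD using (gcd)
import Data.Nat.Coprimality as Coprimality
open import Data.Integer as ℤ using (ℤ; +_)
import Data.Integer.Properties as ℤP
open import Data.Integer.DivMod using ([n/ℕd]*d≤n; div-pos-is-/ℕ)
import Data.Integer.Solver as ℤSolver
open import Data.Rational as ℚ
  using (ℚ; mkℚ; 0ℚ; 1ℚ; _+_; _*_; _-_; -_; _≤_; _<_; _⊓_; ↥_; ↧_; toℚᵘ; ceiling; floor)
import Data.Rational.Properties as ℚP
import Data.Rational.Solver as ℚSolver
open import Data.Rational.Unnormalised as ℚᵘ using (mkℚᵘ; *≡*)
import Data.Rational.Unnormalised.Properties as ℚᵘP
open import Data.Empty using (⊥-elim)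
open import Relation.Nullary using (yes; no)
open import Relation.Binary.PropositionalEquality
  using (_≡_; refl; sym; trans; cong; cong₂; subst; subst₂; module ≡-Reasoning)

-- Embedding ℕ and ℤ into ℚ

/1-canonical : ∀ z → z ℚ./ 1 ≡ mkℚ z 0 (Coprimality.sym (Coprimality.1-coprimeTo ℤ.∣ z ∣))
/1-canonical (+ n)      = ℚP.normalize-coprime (Coprimality.sym (Coprimality.1-coprimeTo n))
/1-canonical ℤ.-[1+ n ] = cong -_ (ℚP.normalize-coprime (Coprimality.sym (Coprimality.1-coprimeTo (suc n))))

/1-mono-≤ : ∀ {i j} → i ℤ.≤ j → i ℚ./ 1 ≤ j ℚ./ 1
/1-mono-≤ {i} {j} i≤j rewrite /1-canonical i | /1-canonical j =
  ℚ.*≤* (subst₂ ℤ._≤_ (sym (ℤP.*-identityʳ i)) (sym (ℤP.*-identityʳ j)) i≤j)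

/1-cancel-≤ : ∀ {i j} → i ℚ./ 1 ≤ j ℚ./ 1 → i ℤ.≤ j
/1-cancel-≤ {i} {j} le rewrite /1-canonical i | /1-canonical j =
  subst₂ ℤ._≤_ (ℤP.*-identityʳ i) (ℤP.*-identityʳ j) (ℚP.drop-*≤* le)

/1-homo-+ : ∀ i j → (i ℤ.+ j) ℚ./ 1 ≡ i ℚ./ 1 + j ℚ./ 1
/1-homo-+ i j rewrite /1-canonical i | /1-canonical j =
  cong (ℚ._/ 1) (sym (cong₂ ℤ._+_ (ℤP.*-identityʳ i) (ℤP.*-identityʳ j)))

/1-homo-* : ∀ i j → (i ℤ.* j) ℚ./ 1 ≡ (i ℚ./ 1) * (j ℚ./ 1)
/1-homo-* i j rewrite /1-canonical i | /1-canonical j = refl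

ℕ→ℚ-mono-≤ : ∀ {a b} → a ℕ.≤ b → ℕ→ℚ a ≤ ℕ→ℚ b
ℕ→ℚ-mono-≤ a≤b = /1-mono-≤ (ℤ.+≤+ a≤b)

ℕ→ℚ-cancel-≤ : ∀ {a b} → ℕ→ℚ a ≤ ℕ→ℚ b → a ℕ.≤ b
ℕ→ℚ-cancel-≤ le = ℤP.drop‿+≤+ (/1-cancel-≤ le)

ℕ→ℚ-homo-+ : ∀ a b → ℕ→ℚ (a ℕ.+ b) ≡ ℕ→ℚ a + ℕ→ℚ b
ℕ→ℚ-homo-+ a b = trans (cong (ℚ._/ 1) (ℤP.pos-+ a b)) (/1-homo-+ (+ a) (+ b))

ℕ→ℚ-homo-* : ∀ a b → ℕ→ℚ (a ℕ.* b) ≡ ℕ→ℚ a * ℕ→ℚ b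
ℕ→ℚ-homo-* a b = trans (cong (ℚ._/ 1) (ℤP.pos-* a b)) (/1-homo-* (+ a) (+ b))

ℕ→ℚ-nonNeg : ∀ a → ℚ.NonNegative (ℕ→ℚ a)
ℕ→ℚ-nonNeg a = ℚP.normalize-nonNeg a 1

ℕ→ℚ-*-mono-≤ : ∀ a {x y} → x ≤ y → ℕ→ℚ a * x ≤ ℕ→ℚ a * y
ℕ→ℚ-*-mono-≤ a = ℚP.*-monoˡ-≤-nonNeg (ℕ→ℚ a) {{ℕ→ℚ-nonNeg a}}

ℕ→ℚ-*-mono-≤-+1 : ∀ a {x y} → x ≤ y + 1ℚ → ℕ→ℚ a * x ≤ ℕ→ℚ a * y + ℕ→ℚ a
ℕ→ℚ-*-mono-≤-+1 a {x} {y} x≤y+1 = ℚP.≤-trans (ℕ→ℚ-*-mono-≤ a x≤y+1) (ℚP.≤-reflexive (begin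
  ℕ→ℚ a * (y + 1ℚ)          ≡⟨ ℚP.*-distribˡ-+ (ℕ→ℚ a) y 1ℚ ⟩
  ℕ→ℚ a * y + ℕ→ℚ a * 1ℚ    ≡⟨ cong (λ s → ℕ→ℚ a * y + s) (ℚP.*-identityʳ (ℕ→ℚ a)) ⟩
  ℕ→ℚ a * y + ℕ→ℚ a         ∎))
  where open ≡-Reasoning

toℚᵘ-/ : ∀ z k → toℚᵘ (z ℚ./ suc k) ℚᵘ.≃ mkℚᵘ z k
toℚᵘ-/ z k = ℚP.toℚᵘ-fromℚᵘ (mkℚᵘ z k)

fracℚ-≡-* : ∀ a p → fracℚ a p ≡ ℕ→ℚ a * fracℚ 1 p
fracℚ-≡-* a zero    = sym (ℚP.*-zeroʳ (ℕ→ℚ a))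
fracℚ-≡-* a (suc k) = ℚP.toℚᵘ-injective (begin
  toℚᵘ (fracℚ a (suc k))                        ≈⟨ toℚᵘ-/ (+ a) k ⟩
  mkℚᵘ (+ a) k                                  ≈⟨ *≡* (solve 2 (λ a p → a :* (con (+ 1) :* p) := (a :* con (+ 1)) :* p) refl (+ a) (+ suc k)) ⟩
  mkℚᵘ (+ a) 0 ℚᵘ.* mkℚᵘ (+ 1) k                ≈⟨ ℚᵘP.≃-sym (ℚᵘP.*-cong (toℚᵘ-/ (+ a) 0) (toℚᵘ-/ (+ 1) k)) ⟩
  toℚᵘ (ℕ→ℚ a) ℚᵘ.* toℚᵘ (fracℚ 1 (suc k))     ≈⟨ ℚᵘP.≃-sym (ℚP.toℚᵘ-homo-* (ℕ→ℚ a) (fracℚ 1 (suc k))) ⟩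
  toℚᵘ (ℕ→ℚ a * fracℚ 1 (suc k))               ∎)
  where open ℚᵘP.≃-Reasoning
        open ℤSolver.+-*-Solver

fracℚ-inverse : ∀ k → fracℚ 1 (suc k) * ℕ→ℚ (suc k) ≡ 1ℚ
fracℚ-inverse k = ℚP.toℚᵘ-injective (begin
  toℚᵘ (fracℚ 1 (suc k) * ℕ→ℚ (suc k))             ≈⟨ ℚP.toℚᵘ-homo-* (fracℚ 1 (suc k)) (ℕ→ℚ (suc k)) ⟩
  toℚᵘ (fracℚ 1 (suc k)) ℚᵘ.* toℚᵘ (ℕ→ℚ (suc k))   ≈⟨ ℚᵘP.*-cong (toℚᵘ-/ (+ 1) k) (toℚᵘ-/ (+ suc k) 0) ⟩
  mkℚᵘ (+ 1) k ℚᵘ.* mkℚᵘ (+ suc k) 0               ≈⟨ *≡* (solve 1 (λ p → (con (+ 1) :* p) :* con (+ 1) := con (+ 1) :* (p :* con (+ 1))) refl (+ suc k)) ⟩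
  mkℚᵘ (+ 1) 0                                     ≈⟨ ℚᵘP.≃-sym (toℚᵘ-/ (+ 1) 0) ⟩
  toℚᵘ 1ℚ                                          ∎)
  where open ℚᵘP.≃-Reasoning
        open ℤSolver.+-*-Solver

fracℚ-*-denominator : ∀ a k → fracℚ a (suc k) * ℕ→ℚ (suc k) ≡ ℕ→ℚ a
fracℚ-*-denominator a k = begin
  fracℚ a (suc k) * ℕ→ℚ (suc k)             ≡⟨ cong (_* ℕ→ℚ (suc k)) (fracℚ-≡-* a (suc k)) ⟩
  ℕ→ℚ a * fracℚ 1 (suc k) * ℕ→ℚ (suc k)     ≡⟨ ℚP.*-assoc (ℕ→ℚ a) _ _ ⟩
  ℕ→ℚ a * (fracℚ 1 (suc k) * ℕ→ℚ (suc k))   ≡⟨ cong (ℕ→ℚ a *_) (fracℚ-inverse k) ⟩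
  ℕ→ℚ a * 1ℚ                                ≡⟨ ℚP.*-identityʳ (ℕ→ℚ a) ⟩
  ℕ→ℚ a                                     ∎
  where open ≡-Reasoning

fracℚ-homo-+ : ∀ a b p → fracℚ (a ℕ.+ b) p ≡ fracℚ a p + fracℚ b p
fracℚ-homo-+ a b p = begin
  fracℚ (a ℕ.+ b) p                          ≡⟨ fracℚ-≡-* (a ℕ.+ b) p ⟩
  ℕ→ℚ (a ℕ.+ b) * fracℚ 1 p                  ≡⟨ cong (_* fracℚ 1 p) (ℕ→ℚ-homo-+ a b) ⟩
  (ℕ→ℚ a + ℕ→ℚ b) * fracℚ 1 p                ≡⟨ ℚP.*-distribʳ-+ (fracℚ 1 p) (ℕ→ℚ a) (ℕ→ℚ b) ⟩
  ℕ→ℚ a * fracℚ 1 p + ℕ→ℚ b * fracℚ 1 p      ≡⟨ sym (cong₂ _+_ (fracℚ-≡-* a p) (fracℚ-≡-* b p)) ⟩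
  fracℚ a p + fracℚ b p                      ∎
  where open ≡-Reasoning

ℕ→ℚ-*-fracℚ : ∀ a b p → ℕ→ℚ a * fracℚ b p ≡ fracℚ a p * ℕ→ℚ b
ℕ→ℚ-*-fracℚ a b p = begin
  ℕ→ℚ a * fracℚ b p              ≡⟨ cong (ℕ→ℚ a *_) (fracℚ-≡-* b p) ⟩
  ℕ→ℚ a * (ℕ→ℚ b * fracℚ 1 p)    ≡⟨ solve 3 (λ a b w → a :* (b :* w) := (a :* w) :* b) refl (ℕ→ℚ a) (ℕ→ℚ b) (fracℚ 1 p) ⟩
  ℕ→ℚ a * fracℚ 1 p * ℕ→ℚ b      ≡⟨ cong (_* ℕ→ℚ b) (sym (fracℚ-≡-* a p)) ⟩
  fracℚ a p * ℕ→ℚ b              ∎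
  where open ≡-Reasoning
        open ℚSolver.+-*-Solver

-- Ceiling division versus exact division

ceilDiv-mono-≤ : ∀ p {a b} → a ℕ.≤ b → ceilDiv a p ℕ.≤ ceilDiv b p
ceilDiv-mono-≤ zero    _   = ℕ.z≤n
ceilDiv-mono-≤ (suc k) a≤b = /-monoˡ-≤ (suc k) (ℕP.+-monoˡ-≤ k a≤b)

≤-ceilDiv-* : ∀ a k → a ℕ.≤ ceilDiv a (suc k) ℕ.* suc k
≤-ceilDiv-* a k = ℕP.+-cancelʳ-≤ k a _ (begin
  a ℕ.+ k                                             ≡⟨ m≡m%n+[m/n]*n (a ℕ.+ k) (suc k) ⟩
  (a ℕ.+ k) % suc k ℕ.+ ceilDiv a (suc k) ℕ.* suc k   ≤⟨ ℕP.+-monoˡ-≤ _ (ℕP.≤-pred (m%n<n (a ℕ.+ k) (suc k))) ⟩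
  k ℕ.+ ceilDiv a (suc k) ℕ.* suc k                   ≡⟨ ℕP.+-comm k _ ⟩
  ceilDiv a (suc k) ℕ.* suc k ℕ.+ k                   ∎)
  where open ℕP.≤-Reasoning

ceilDiv-*-≤ : ∀ a k → ceilDiv a (suc k) ℕ.* suc k ℕ.≤ a ℕ.+ suc k
ceilDiv-*-≤ a k = ℕP.≤-trans (m/n*n≤m (a ℕ.+ k) (suc k)) (ℕP.+-monoʳ-≤ a (ℕP.n≤1+n k))

ceilDiv-aligned : ∀ q J k → J ℕ.≤ suc k → ceilDiv (q ℕ.* suc k ℕ.+ J) (suc k) ℕ.≤ suc q
ceilDiv-aligned q J k J≤p = ℕP.≤-pred (m<n*o⇒m/o<n {n = suc (suc q)} (begin-strict
  q ℕ.* suc k ℕ.+ J ℕ.+ k              ≡⟨ ℕP.+-assoc (q ℕ.* suc k) J k ⟩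
  q ℕ.* suc k ℕ.+ (J ℕ.+ k)            <⟨ ℕP.+-monoʳ-< (q ℕ.* suc k) (ℕP.+-mono-≤-< J≤p (ℕP.n<1+n k)) ⟩
  q ℕ.* suc k ℕ.+ (suc k ℕ.+ suc k)    ≡⟨ solve 2 (λ q p → q :* p :+ (p :+ p) := p :+ (p :+ q :* p)) refl q (suc k) ⟩
  suc (suc q) ℕ.* suc k                ∎))
  where open ℕP.≤-Reasoning
        open ℕSolver.+-*-Solver

≤-by-scaling : ∀ k {x y a b} → x * ℕ→ℚ (suc k) ≡ ℕ→ℚ a → y * ℕ→ℚ (suc k) ≡ ℕ→ℚ b → a ℕ.≤ b → x ≤ y
≤-by-scaling k {x} {y} xp≡a yp≡b a≤b = ℚP.*-cancelʳ-≤-pos (ℕ→ℚ (suc k)) {{ℚP.normalize-pos (suc k) 1}}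
  (subst₂ _≤_ (sym xp≡a) (sym yp≡b) (ℕ→ℚ-mono-≤ a≤b))

fracℚ+1-*-denominator : ∀ a k → (fracℚ a (suc k) + 1ℚ) * ℕ→ℚ (suc k) ≡ ℕ→ℚ (a ℕ.+ suc k)
fracℚ+1-*-denominator a k = begin
  (fracℚ a (suc k) + 1ℚ) * ℕ→ℚ (suc k)                     ≡⟨ ℚP.*-distribʳ-+ (ℕ→ℚ (suc k)) (fracℚ a (suc k)) 1ℚ ⟩
  fracℚ a (suc k) * ℕ→ℚ (suc k) + 1ℚ * ℕ→ℚ (suc k)         ≡⟨ cong₂ _+_ (fracℚ-*-denominator a k) (ℚP.*-identityˡ (ℕ→ℚ (suc k))) ⟩
  ℕ→ℚ a + ℕ→ℚ (suc k)                                      ≡⟨ sym (ℕ→ℚ-homo-+ a (suc k)) ⟩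
  ℕ→ℚ (a ℕ.+ suc k)                                        ∎
  where open ≡-Reasoning

0≤0+1 : ℕ→ℚ 0 ≤ 0ℚ + 1ℚ
0≤0+1 = ℚP.nonNegative⁻¹ 1ℚ

fracℚ≤ceilDiv : ∀ a p → fracℚ a p ≤ ℕ→ℚ (ceilDiv a p)
fracℚ≤ceilDiv a zero    = ℚP.≤-refl
fracℚ≤ceilDiv a (suc k) =
  ≤-by-scaling k (fracℚ-*-denominator a k) (sym (ℕ→ℚ-homo-* (ceilDiv a (suc k)) (suc k))) (≤-ceilDiv-* a k)

ceilDiv≤fracℚ+1 : ∀ a p → ℕ→ℚ (ceilDiv a p) ≤ fracℚ a p + 1ℚ
ceilDiv≤fracℚ+1 a zero    = 0≤0+1
ceilDiv≤fracℚ+1 a (suc k) =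
  ≤-by-scaling k (sym (ℕ→ℚ-homo-* (ceilDiv a (suc k)) (suc k))) (fracℚ+1-*-denominator a k) (ceilDiv-*-≤ a k)

ceilDiv-aligned≤fracℚ+1 : ∀ t J p → p ∣ t → J ℕ.≤ p → ℕ→ℚ (ceilDiv (t ℕ.+ J) p) ≤ fracℚ t p + 1ℚ
ceilDiv-aligned≤fracℚ+1 t J zero    _              _   = 0≤0+1
ceilDiv-aligned≤fracℚ+1 t J (suc k) (divides q refl) J≤p =
  ≤-by-scaling k (sym (ℕ→ℚ-homo-* (ceilDiv (t ℕ.+ J) (suc k)) (suc k))) (fracℚ+1-*-denominator t k)
    (subst (ceilDiv (t ℕ.+ J) (suc k) ℕ.* suc k ℕ.≤_) (ℕP.+-comm (suc k) t)
      (ℕP.*-monoˡ-≤ (suc k) (ceilDiv-aligned q J k J≤p)))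

floor-*-≤ : ∀ q → floor q ℤ.* ↧ q ℤ.≤ ↥ q
floor-*-≤ (mkℚ n d _) = subst (λ v → v ℤ.* + suc d ℤ.≤ n) (sym (div-pos-is-/ℕ n (suc d))) ([n/ℕd]*d≤n n (suc d))

≤-ceiling-* : ∀ q → ↥ q ℤ.≤ ceiling q ℤ.* ↧ q
≤-ceiling-* q@(mkℚ n _ _) = subst₂ ℤ._≤_ (ℤP.neg-involutive n) (ℤP.neg-distribˡ-* (floor (- q)) (↧ q))
  (ℤP.neg-mono-≤ (subst₂ (λ d m → floor (- q) ℤ.* d ℤ.≤ m) (ℚP.↧-neg q) (ℚP.↥-neg q) (floor-*-≤ (- q))))

≤-ceiling : ∀ q → q ≤ ceiling q ℚ./ 1
≤-ceiling q rewrite /1-canonical (ceiling q) =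
  ℚ.*≤* (subst (ℤ._≤ ceiling q ℤ.* ↧ q) (sym (ℤP.*-identityʳ (↥ q))) (≤-ceiling-* q))

ceiling-nonNeg : ∀ {q} → 0ℚ ≤ q → + ℤ.∣ ceiling q ∣ ≡ ceiling q
ceiling-nonNeg {q} 0≤q = ℤP.0≤i⇒+∣i∣≡i (/1-cancel-≤ (ℚP.≤-trans 0≤q (≤-ceiling q)))

sumℕ-mono-≤ : ∀ {m} {f g : Fin m → ℕ} → (∀ i → f i ℕ.≤ g i) → sumℕ f ℕ.≤ sumℕ g
sumℕ-mono-≤ {zero}  f≤g = ℕ.z≤n
sumℕ-mono-≤ {suc m} f≤g = ℕP.+-mono-≤ (f≤g zero) (sumℕ-mono-≤ (λ i → f≤g (suc i)))

sumℚ-mono-≤ : ∀ {m} {f g : Fin m → ℚ} → (∀ i → f i ≤ g i) → sumℚ f ≤ sumℚ g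
sumℚ-mono-≤ {zero}  f≤g = ℚP.≤-refl
sumℚ-mono-≤ {suc m} f≤g = ℚP.+-mono-≤ (f≤g zero) (sumℚ-mono-≤ (λ i → f≤g (suc i)))

sumℚ-cong : ∀ {m} {f g : Fin m → ℚ} → (∀ i → f i ≡ g i) → sumℚ f ≡ sumℚ g
sumℚ-cong {zero}  f≡g = refl
sumℚ-cong {suc m} f≡g = cong₂ _+_ (f≡g zero) (sumℚ-cong (λ i → f≡g (suc i)))

sumℚ-+ : ∀ {m} (f g : Fin m → ℚ) → sumℚ (λ i → f i + g i) ≡ sumℚ f + sumℚ g
sumℚ-+ {zero}  f g = refl
sumℚ-+ {suc m} f g = trans (cong (λ s → f zero + g zero + s) (sumℚ-+ (λ i → f (suc i)) (λ i → g (suc i))))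
  (solve 4 (λ a b c d → (a :+ b) :+ (c :+ d) := (a :+ c) :+ (b :+ d)) refl
    (f zero) (g zero) (sumℚ (λ i → f (suc i))) (sumℚ (λ i → g (suc i))))
  where open ℚSolver.+-*-Solver

sumℚ-*ʳ : ∀ {m} (f : Fin m → ℚ) x → sumℚ (λ i → f i * x) ≡ sumℚ f * x
sumℚ-*ʳ {zero}  f x = sym (ℚP.*-zeroˡ x)
sumℚ-*ʳ {suc m} f x = trans (cong (λ s → f zero * x + s) (sumℚ-*ʳ (λ i → f (suc i)) x))
  (sym (ℚP.*-distribʳ-+ x (f zero) _))

ℕ→ℚ-sumℕ : ∀ {m} (f : Fin m → ℕ) → ℕ→ℚ (sumℕ f) ≡ sumℚ (λ i → ℕ→ℚ (f i))
ℕ→ℚ-sumℕ {zero}  f = refl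
ℕ→ℚ-sumℕ {suc m} f = trans (ℕ→ℚ-homo-+ (f zero) _) (cong (λ s → ℕ→ℚ (f zero) + s) (ℕ→ℚ-sumℕ (λ i → f (suc i))))

lcm-pos : ∀ {a b} → 1 ℕ.≤ a → 1 ℕ.≤ b → 1 ℕ.≤ lcm a b
lcm-pos {a} {b} 1≤a 1≤b with lcm a b in eq
... | suc _ = ℕ.s≤s ℕ.z≤n
... | zero  = ⊥-elim (ℕP.<⇒≢ (ℕP.*-mono-≤ 1≤a 1≤b)
  (sym (trans (sym (gcd*lcm a b)) (trans (cong (gcd a b ℕ.*_) eq) (ℕP.*-zeroʳ (gcd a b))))))

lcmFin-pos : ∀ {m} {f : Fin m → ℕ} → (∀ i → 1 ℕ.≤ f i) → 1 ℕ.≤ lcmFin f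
lcmFin-pos {zero}  _    = ℕ.s≤s ℕ.z≤n
lcmFin-pos {suc m} 1≤f = lcm-pos (1≤f zero) (lcmFin-pos (λ i → 1≤f (suc i)))

∣lcmFin : ∀ {m} (f : Fin m → ℕ) i → f i ∣ lcmFin f
∣lcmFin f zero    = m∣lcm[m,n] (f zero) _
∣lcmFin f (suc i) = ∣-trans (∣lcmFin (λ j → f (suc j)) i) (n∣lcm[m,n] (f zero) _)

divℚ-*-inverse : ∀ x {y} → 0ℚ < y → divℚ x y * y ≡ x
divℚ-*-inverse x {y} 0<y with y ℚ.≟ 0ℚ
... | yes y≡0 = ⊥-elim (ℚP.<-irrefl (sym y≡0) 0<y)
... | no  y≢0 = begin
  x * ℚ.1/ y * y     ≡⟨ ℚP.*-assoc x (ℚ.1/ y) y ⟩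
  x * (ℚ.1/ y * y)   ≡⟨ cong (x *_) (ℚP.*-inverseˡ y) ⟩
  x * 1ℚ             ≡⟨ ℚP.*-identityʳ x ⟩
  x                  ∎
  where open ≡-Reasoning
        instance _ = ℚ.≢-nonZero y≢0

≤-divℚ : ∀ {x y z} → 0ℚ < y → z * y ≤ x → z ≤ divℚ x y
≤-divℚ {x} {y} 0<y zy≤x =
  ℚP.*-cancelʳ-≤-pos y {{ℚ.positive 0<y}} (subst (_ ≤_) (sym (divℚ-*-inverse x 0<y)) zy≤x)

divℚ-≤ : ∀ {x y z} → 0ℚ < y → x ≤ z * y → divℚ x y ≤ z
divℚ-≤ {x} {y} 0<y x≤zy =
  ℚP.*-cancelʳ-≤-pos y {{ℚ.positive 0<y}} (subst (_≤ _) (sym (divℚ-*-inverse x 0<y)) x≤zy)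

module _ where
  open ℚSolver.+-*-Solver

  a+u*x≤x⇒a≤x*[1-u] : ∀ a u x → a + u * x ≤ x → a ≤ x * (1ℚ - u)
  a+u*x≤x⇒a≤x*[1-u] a u x h = subst₂ _≤_
    (solve 3 (λ a u x → (a :+ u :* x) :- u :* x := a) refl a u x)
    (solve 2 (λ u x → x :- u :* x := x :* (con 1ℚ :- u)) refl u x)
    (ℚP.+-monoˡ-≤ (- (u * x)) h)

  a≤x*[1-u]⇒a+u*x≤x : ∀ a u x → a ≤ x * (1ℚ - u) → a + u * x ≤ x
  a≤x*[1-u]⇒a+u*x≤x a u x h = subst (a + u * x ≤_)
    (solve 2 (λ u x → x :* (con 1ℚ :- u) :+ u :* x := x) refl u x)
    (ℚP.+-monoˡ-≤ (u * x) h)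

  x≤a+u*x⇒x*[1-u]≤a : ∀ a u x → x ≤ a + u * x → x * (1ℚ - u) ≤ a
  x≤a+u*x⇒x*[1-u]≤a a u x h = subst₂ _≤_
    (solve 2 (λ u x → x :- u :* x := x :* (con 1ℚ :- u)) refl u x)
    (solve 3 (λ a u x → (a :+ u :* x) :- u :* x := a) refl a u x)
    (ℚP.+-monoˡ-≤ (- (u * x)) h)

-- Processor demand

module Demand {m} (hp : Fin m → Task) (τn : Task) where

  cᵢ pᵢ Jᵢ : Fin m → ℕ
  cᵢ i = c (hp i)
  pᵢ i = p (hp i)
  Jᵢ i = J (hp i)

  releases : ℕ → Fin m → ℕ
  releases t i = ceilDiv (t ℕ.+ Jᵢ i) (pᵢ i)

  -- Feasible hp τn t unfolds to demand t ℕ.≤ t.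
  demand : ℕ → ℕ
  demand t = c τn ℕ.+ sumℕ (λ i → cᵢ i ℕ.* releases t i)

  jitterLoad : ℚ
  jitterLoad = sumℚ (λ i → fracℚ (Jᵢ i) (pᵢ i) * ℕ→ℚ (cᵢ i))

  demand-mono-≤ : ∀ {s t} → s ℕ.≤ t → demand s ℕ.≤ demand t
  demand-mono-≤ s≤t = ℕP.+-monoʳ-≤ (c τn) (sumℕ-mono-≤ (λ i →
    ℕP.*-monoʳ-≤ (cᵢ i) (ceilDiv-mono-≤ (pᵢ i) (ℕP.+-monoˡ-≤ (Jᵢ i) s≤t))))

  ℕ→ℚ-demand : ∀ t → ℕ→ℚ (demand t) ≡ ℕ→ℚ (c τn) + sumℚ (λ i → ℕ→ℚ (cᵢ i) * ℕ→ℚ (releases t i))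
  ℕ→ℚ-demand t = trans (ℕ→ℚ-homo-+ (c τn) _) (cong (λ s → ℕ→ℚ (c τn) + s)
    (trans (ℕ→ℚ-sumℕ (λ i → cᵢ i ℕ.* releases t i)) (sumℚ-cong (λ i → ℕ→ℚ-homo-* (cᵢ i) (releases t i)))))

  fluidInterference : ∀ t → sumℚ (λ i → ℕ→ℚ (cᵢ i) * fracℚ (t ℕ.+ Jᵢ i) (pᵢ i)) ≡ jitterLoad + Util hp * ℕ→ℚ t
  fluidInterference t = begin
    sumℚ (λ i → ℕ→ℚ (cᵢ i) * fracℚ (t ℕ.+ Jᵢ i) (pᵢ i))
      ≡⟨ sumℚ-cong split ⟩
    sumℚ (λ i → fracℚ (Jᵢ i) (pᵢ i) * ℕ→ℚ (cᵢ i) + fracℚ (cᵢ i) (pᵢ i) * ℕ→ℚ t)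
      ≡⟨ sumℚ-+ (λ i → fracℚ (Jᵢ i) (pᵢ i) * ℕ→ℚ (cᵢ i)) (λ i → fracℚ (cᵢ i) (pᵢ i) * ℕ→ℚ t) ⟩
    jitterLoad + sumℚ (λ i → fracℚ (cᵢ i) (pᵢ i) * ℕ→ℚ t)
      ≡⟨ cong (λ s → jitterLoad + s) (sumℚ-*ʳ (λ i → fracℚ (cᵢ i) (pᵢ i)) (ℕ→ℚ t)) ⟩
    jitterLoad + Util hp * ℕ→ℚ t
      ∎
    where
    open ≡-Reasoning
    split : ∀ i → ℕ→ℚ (cᵢ i) * fracℚ (t ℕ.+ Jᵢ i) (pᵢ i) ≡ fracℚ (Jᵢ i) (pᵢ i) * ℕ→ℚ (cᵢ i) + fracℚ (cᵢ i) (pᵢ i) * ℕ→ℚ t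
    split i = begin
      ℕ→ℚ (cᵢ i) * fracℚ (t ℕ.+ Jᵢ i) (pᵢ i)
        ≡⟨ cong (ℕ→ℚ (cᵢ i) *_) (fracℚ-homo-+ t (Jᵢ i) (pᵢ i)) ⟩
      ℕ→ℚ (cᵢ i) * (fracℚ t (pᵢ i) + fracℚ (Jᵢ i) (pᵢ i))
        ≡⟨ ℚP.*-distribˡ-+ (ℕ→ℚ (cᵢ i)) _ _ ⟩
      ℕ→ℚ (cᵢ i) * fracℚ t (pᵢ i) + ℕ→ℚ (cᵢ i) * fracℚ (Jᵢ i) (pᵢ i)
        ≡⟨ cong₂ _+_ (ℕ→ℚ-*-fracℚ (cᵢ i) t (pᵢ i)) (ℚP.*-comm (ℕ→ℚ (cᵢ i)) _) ⟩
      fracℚ (cᵢ i) (pᵢ i) * ℕ→ℚ t + fracℚ (Jᵢ i) (pᵢ i) * ℕ→ℚ (cᵢ i)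
        ≡⟨ ℚP.+-comm (fracℚ (cᵢ i) (pᵢ i) * ℕ→ℚ t) _ ⟩
      fracℚ (Jᵢ i) (pᵢ i) * ℕ→ℚ (cᵢ i) + fracℚ (cᵢ i) (pᵢ i) * ℕ→ℚ t
        ∎

  private
    Cn S : ℚ
    Cn = ℕ→ℚ (c τn)
    S  = ℕ→ℚ (sumℕ cᵢ)

  demand-lower : ∀ t → Cn + jitterLoad + Util hp * ℕ→ℚ t ≤ ℕ→ℚ (demand t)
  demand-lower t = begin
    Cn + jitterLoad + Util hp * ℕ→ℚ t                              ≡⟨ ℚP.+-assoc Cn jitterLoad _ ⟩
    Cn + (jitterLoad + Util hp * ℕ→ℚ t)                            ≡⟨ cong (λ x → Cn + x) (sym (fluidInterference t)) ⟩
    Cn + sumℚ (λ i → ℕ→ℚ (cᵢ i) * fracℚ (t ℕ.+ Jᵢ i) (pᵢ i))      ≤⟨ ℚP.+-monoʳ-≤ Cn (sumℚ-mono-≤ (λ i →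
                                                                        ℕ→ℚ-*-mono-≤ (cᵢ i) (fracℚ≤ceilDiv (t ℕ.+ Jᵢ i) (pᵢ i)))) ⟩
    Cn + sumℚ (λ i → ℕ→ℚ (cᵢ i) * ℕ→ℚ (releases t i))             ≡⟨ sym (ℕ→ℚ-demand t) ⟩
    ℕ→ℚ (demand t)                                                 ∎
    where open ℚP.≤-Reasoning

  demand-upper : ∀ t → ℕ→ℚ (demand t) ≤ Cn + jitterLoad + S + Util hp * ℕ→ℚ t
  demand-upper t = begin
    ℕ→ℚ (demand t)
      ≡⟨ ℕ→ℚ-demand t ⟩
    Cn + sumℚ (λ i → ℕ→ℚ (cᵢ i) * ℕ→ℚ (releases t i))
      ≤⟨ ℚP.+-monoʳ-≤ Cn (sumℚ-mono-≤ (λ i → ℕ→ℚ-*-mono-≤-+1 (cᵢ i) (ceilDiv≤fracℚ+1 (t ℕ.+ Jᵢ i) (pᵢ i)))) ⟩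
    Cn + sumℚ (λ i → ℕ→ℚ (cᵢ i) * fracℚ (t ℕ.+ Jᵢ i) (pᵢ i) + ℕ→ℚ (cᵢ i))
      ≡⟨ cong (λ x → Cn + x) (sumℚ-+ (λ i → ℕ→ℚ (cᵢ i) * fracℚ (t ℕ.+ Jᵢ i) (pᵢ i)) (λ i → ℕ→ℚ (cᵢ i))) ⟩
    Cn + (sumℚ (λ i → ℕ→ℚ (cᵢ i) * fracℚ (t ℕ.+ Jᵢ i) (pᵢ i)) + sumℚ (λ i → ℕ→ℚ (cᵢ i)))
      ≡⟨ cong (λ x → Cn + x) (cong₂ _+_ (fluidInterference t) (sym (ℕ→ℚ-sumℕ cᵢ))) ⟩
    Cn + (jitterLoad + Util hp * ℕ→ℚ t + S)
      ≡⟨ solve 4 (λ a j u s → a :+ (j :+ u :+ s) := a :+ j :+ s :+ u) refl Cn jitterLoad (Util hp * ℕ→ℚ t) S ⟩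
    Cn + jitterLoad + S + Util hp * ℕ→ℚ t
      ∎
    where open ℚP.≤-Reasoning
          open ℚSolver.+-*-Solver

  demand-upper-aligned : ∀ t → (∀ i → Jᵢ i ℕ.≤ pᵢ i) → (∀ i → pᵢ i ∣ t) →
                         ℕ→ℚ (demand t) ≤ ℕ→ℚ (sumℕ cᵢ ℕ.+ c τn) + Util hp * ℕ→ℚ t
  demand-upper-aligned t J≤p p∣t = begin
    ℕ→ℚ (demand t)
      ≡⟨ ℕ→ℚ-demand t ⟩
    Cn + sumℚ (λ i → ℕ→ℚ (cᵢ i) * ℕ→ℚ (releases t i))
      ≤⟨ ℚP.+-monoʳ-≤ Cn (sumℚ-mono-≤ (λ i →
           ℕ→ℚ-*-mono-≤-+1 (cᵢ i) (ceilDiv-aligned≤fracℚ+1 t (Jᵢ i) (pᵢ i) (p∣t i) (J≤p i)))) ⟩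
    Cn + sumℚ (λ i → ℕ→ℚ (cᵢ i) * fracℚ t (pᵢ i) + ℕ→ℚ (cᵢ i))
      ≡⟨ cong (λ x → Cn + x) (sumℚ-cong (λ i → cong (_+ ℕ→ℚ (cᵢ i)) (ℕ→ℚ-*-fracℚ (cᵢ i) t (pᵢ i)))) ⟩
    Cn + sumℚ (λ i → fracℚ (cᵢ i) (pᵢ i) * ℕ→ℚ t + ℕ→ℚ (cᵢ i))
      ≡⟨ cong (λ x → Cn + x) (sumℚ-+ (λ i → fracℚ (cᵢ i) (pᵢ i) * ℕ→ℚ t) (λ i → ℕ→ℚ (cᵢ i))) ⟩
    Cn + (sumℚ (λ i → fracℚ (cᵢ i) (pᵢ i) * ℕ→ℚ t) + sumℚ (λ i → ℕ→ℚ (cᵢ i)))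
      ≡⟨ cong (λ x → Cn + x) (cong₂ _+_ (sumℚ-*ʳ (λ i → fracℚ (cᵢ i) (pᵢ i)) (ℕ→ℚ t)) (sym (ℕ→ℚ-sumℕ cᵢ))) ⟩
    Cn + (Util hp * ℕ→ℚ t + S)
      ≡⟨ solve 3 (λ a u s → a :+ (u :+ s) := s :+ a :+ u) refl Cn (Util hp * ℕ→ℚ t) S ⟩
    S + Cn + Util hp * ℕ→ℚ t
      ≡⟨ cong (_+ Util hp * ℕ→ℚ t) (sym (ℕ→ℚ-homo-+ (sumℕ cᵢ) (c τn))) ⟩
    ℕ→ℚ (sumℕ cᵢ ℕ.+ c τn) + Util hp * ℕ→ℚ t
      ∎
    where open ℚP.≤-Reasoning
          open ℚSolver.+-*-Solver

module Bounds {m} (hp : Fin m → Task) (τn : Task) (U<1 : Util hp < 1ℚ) where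

  open Demand hp τn public

  D : ℚ
  D = 1ℚ - Util hp

  0<D : 0ℚ < D
  0<D = subst (_< D) (ℚP.+-inverseʳ (Util hp)) (ℚP.+-monoˡ-< (- Util hp) U<1)

  ell≤feasible : ∀ {t} → Feasible hp τn t → ell hp τn ≤ ℕ→ℚ t
  ell≤feasible {t} feasible = divℚ-≤ 0<D (a+u*x≤x⇒a≤x*[1-u] _ (Util hp) (ℕ→ℚ t)
    (ℚP.≤-trans (demand-lower t) (ℕ→ℚ-mono-≤ feasible)))

  ≤demand⇒≤u₁ : ∀ {t} → t ℕ.≤ demand t → ℕ→ℚ t ≤ u₁ hp τn
  ≤demand⇒≤u₁ {t} t≤demand = ℚP.*-cancelʳ-≤-pos D {{ℚ.positive 0<D}}
    (subst (ℕ→ℚ t * D ≤_) (sym u₁*D) (x≤a+u*x⇒x*[1-u]≤a _ (Util hp) (ℕ→ℚ t)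
      (ℚP.≤-trans (ℕ→ℚ-mono-≤ t≤demand) (demand-upper t))))
    where
    A S : ℚ
    A = ℕ→ℚ (c τn) + jitterLoad
    S = ℕ→ℚ (sumℕ cᵢ)
    u₁*D : u₁ hp τn * D ≡ A + S
    u₁*D = trans (ℚP.*-distribʳ-+ D (divℚ A D) (divℚ S D))
                 (cong₂ _+_ (divℚ-*-inverse A 0<D) (divℚ-*-inverse S 0<D))

  u₂-feasible : (∀ i → WellFormed (hp i)) → Σ ℕ (λ t → ℕ→ℚ t ≡ u₂ hp τn × Feasible hp τn t)
  u₂-feasible wf = k ℕ.* L , t≡u₂ , ℕ→ℚ-cancel-≤ (ℚP.≤-trans
      (demand-upper-aligned (k ℕ.* L) J≤p (λ i → ∣-trans (∣lcmFin pᵢ i) (n∣m*n k)))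
      (a≤x*[1-u]⇒a+u*x≤x N (Util hp) (ℕ→ℚ (k ℕ.* L)) N≤t*D))
    where
    1≤p : ∀ i → 1 ℕ.≤ pᵢ i
    1≤p i = proj₁ (proj₂ (wf i))
    J≤p : ∀ i → Jᵢ i ℕ.≤ pᵢ i
    J≤p i = proj₂ (proj₂ (proj₂ (proj₂ (wf i))))
    L : ℕ
    L = lcmFin pᵢ
    N : ℚ
    N = ℕ→ℚ (sumℕ cᵢ ℕ.+ c τn)
    0<L : 0ℚ < ℕ→ℚ L
    0<L = ℚP.<-≤-trans (ℚP.positive⁻¹ 1ℚ) (ℕ→ℚ-mono-≤ (lcmFin-pos 1≤p))
    0<DL : 0ℚ < D * ℕ→ℚ L
    0<DL = ℚP.positive⁻¹ (D * ℕ→ℚ L) {{ℚP.pos*pos⇒pos D {{ℚ.positive 0<D}} (ℕ→ℚ L) {{ℚ.positive 0<L}}}}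
    X : ℚ
    X = divℚ N (D * ℕ→ℚ L)
    0≤X : 0ℚ ≤ X
    0≤X = ≤-divℚ 0<DL (subst (_≤ N) (sym (ℚP.*-zeroˡ (D * ℕ→ℚ L))) (ℕ→ℚ-mono-≤ {0} {sumℕ cᵢ ℕ.+ c τn} ℕ.z≤n))
    k : ℕ
    k = ℤ.∣ ceiling X ∣
    X≤k : X ≤ ℕ→ℚ k
    X≤k = subst (λ z → X ≤ z ℚ./ 1) (sym (ceiling-nonNeg 0≤X)) (≤-ceiling X)
    t≡u₂ : ℕ→ℚ (k ℕ.* L) ≡ u₂ hp τn
    t≡u₂ = trans (ℕ→ℚ-homo-* k L) (cong (λ z → z ℚ./ 1 * ℕ→ℚ L) (ceiling-nonNeg 0≤X))
    N≤t*D : N ≤ ℕ→ℚ (k ℕ.* L) * D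
    N≤t*D = begin
      N                              ≡⟨ sym (divℚ-*-inverse N 0<DL) ⟩
      X * (D * ℕ→ℚ L)                ≤⟨ ℚP.*-monoʳ-≤-nonNeg (D * ℕ→ℚ L) {{ℚ.nonNegative (ℚP.<⇒≤ 0<DL)}} X≤k ⟩
      ℕ→ℚ k * (D * ℕ→ℚ L)            ≡⟨ solve 3 (λ k d l → k :* (d :* l) := k :* l :* d) refl (ℕ→ℚ k) D (ℕ→ℚ L) ⟩
      ℕ→ℚ k * ℕ→ℚ L * D              ≡⟨ cong (_* D) (sym (ℕ→ℚ-homo-* k L)) ⟩
      ℕ→ℚ (k ℕ.* L) * D              ∎
      where open ℚP.≤-Reasoning
            open ℚSolver.+-*-Solver

lemma5 : (m : ℕ) → 1 Data.Nat.≤ m → (hp : Fin m → Task) → (τn : Task)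
       → (∀ i → WellFormed (hp i)) → WellFormed τn
       → Util hp < 1ℚ
       → (r : ℕ) → IsResponseTime hp τn r
       → (ell hp τn ≤ ℕ→ℚ r) × (ℕ→ℚ r ≤ (u₁ hp τn ⊓ u₂ hp τn))
lemma5 m _ hp τn wf _ U<1 r (feasible , minimal) = ell≤feasible feasible , ℚP.⊓-glb r≤u₁ r≤u₂
  where
  open Bounds hp τn U<1
  r≤u₁ : ℕ→ℚ r ≤ u₁ hp τn
  r≤u₁ = ≤demand⇒≤u₁ (minimal (demand r) (demand-mono-≤ feasible))
  r≤u₂ : ℕ→ℚ r ≤ u₂ hp τn
  r≤u₂ = let (t , t≡u₂ , feasible-t) = u₂-feasible wf in
    subst (ℕ→ℚ r ≤_) t≡u₂ (ℕ→ℚ-mono-≤ (minimal t feasible-t))
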